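{- For all positive integers $r,t$ and every integer $k$ with $1-\lceil\min(r,t)/2\rceil\le k\le\lfloor\min(r,t)/2\rfloor$, $\mathcal{M}_k(K_{r,t})=\left\lceil\frac{r+2k}{2}\right\rceil+\left\lceil\frac{t+2k}{2}\right\rceil$.
   Context: All graphs are finite and simple; $K_{r,t}$ is the complete bipartite graph with parts of sizes $r$ and $t$ (minimum degree $\min(r,t)$). For a vertex $v$, $\delta(v)$ is its degree and $\delta_X(v)=|N(v)\cap X|$. For an integer $k$ with $1-\lceil\delta(G)/2\rceil\le k\le\lfloor\delta(G)/2\rfloor$, a nonempty set $M\subseteq V(G)$ is a $k$-monopoly if every vertex $v$ satisfies $\delta_M(v)\ge\frac{\delta(v)}{2}+k$; $\mathcal{M}_k(G)$ is the minimum cardinality of a $k$-monopoly. -}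

module Defs where

open import Data.Bool using (Bool; true; false; _xor_)
open import Data.Nat as ℕ using (ℕ; _<ᵇ_)
open import Data.Fin using (Fin; toℕ)
open import Data.Fin.Subset using (Subset; _∩_; ∣_∣; Nonempty)
open import Data.Vec using (tabulate)
open import Data.Integer as ℤ using (ℤ; +_; _+_; _*_)
open import Data.Integer.DivMod using (_/ℕ_)
open import Relation.Binary.PropositionalEquality using (_≡_)
open import Data.Product using (_×_; Σ)

record Graph : Set where
  field
    n     : ℕ
    adj   : Fin n → Fin n → Bool
    sym   : ∀ u v → adj u v ≡ adj v u
    irref : ∀ v → adj v v ≡ false

module _ (G : Graph) where
  open Graph G

  N : Fin n → Subset n
  N v = tabulate (adj v)

  deg : Fin n → ℕ
  deg v = ∣ N v ∣

  degIn : Subset n → Fin n → ℕ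
  degIn X v = ∣ N v ∩ X ∣

  -- M is a k-monopoly: nonempty and every vertex v satisfies
  -- δ_M(v) ≥ δ(v)/2 + k, i.e. (multiplying by 2) 2 δ_M(v) ≥ δ(v) + 2k.
  IsKMonopoly : ℤ → Subset n → Set
  IsKMonopoly k M =
    Nonempty M × (∀ v → (+ deg v) + (+ 2) * k ℤ.≤ (+ 2) * (+ degIn M v))

  MonopolyNumber : ℤ → ℕ → Set
  MonopolyNumber k m =
    Σ (Subset n) (λ M → IsKMonopoly k M × ∣ M ∣ ≡ m)
    × (∀ M → IsKMonopoly k M → m ℕ.≤ ∣ M ∣)

-- Complete bipartite graph K_{r,t} on Fin (r + t): vertices with index < r
-- form one part, the remaining t vertices the other; adjacency iff in different parts.
K : ℕ → ℕ → Graph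
K r t = record
  { n = r ℕ.+ t
  ; adj = λ u v → (toℕ u <ᵇ r) xor (toℕ v <ᵇ r)
  ; sym = λ u v → xor-comm (toℕ u <ᵇ r) (toℕ v <ᵇ r)
  ; irref = λ v → xor-self (toℕ v <ᵇ r)
  }
  where
  xor-comm : ∀ a b → (a xor b) ≡ (b xor a)
  xor-comm true true = _≡_.refl
  xor-comm true false = _≡_.refl
  xor-comm false true = _≡_.refl
  xor-comm false false = _≡_.refl
  xor-self : ∀ a → (a xor a) ≡ false
  xor-self true = _≡_.refl
  xor-self false = _≡_.refl

-- integer ceiling / floor of a/2 (⌊·⌋ via Euclidean division by 2, which is floor division)
⌈_/2⌉ : ℤ → ℤ
⌈ a /2⌉ = (a + + 1) /ℕ 2

⌊_/2⌋ : ℤ → ℤ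
⌊ a /2⌋ = a /ℕ 2

-- In K_{r,t} a vertex of one part sees exactly the other part, so M is a k-monopoly iff
-- it meets the part of size r in at least ⌈(r+2k)/2⌉ vertices and the part of size t in
-- at least ⌈(t+2k)/2⌉ vertices; the range of k makes both numbers lie between 1 and the
-- size of the part, so the bounds are attained simultaneously.
module Submission where

open import Defs
open import Data.Nat using (ℕ; NonZero; _⊓_)
open import Data.Integer as ℤ using (ℤ; +_; _+_; _-_; _*_)
open import Data.Product using (_×_; Σ)
open import Relation.Binary.PropositionalEquality using (_≡_)

open import Data.Bool using (Bool; true; false; not; _xor_)
open import Data.Nat as ℕ using (suc; _<ᵇ_; z≤n; s≤s)
import Data.Nat.Properties as ℕ
open import Data.Integer using (+≤+)
open import Data.Integer.Properties
  using (≤-trans; ≤-refl; +-mono-≤; +-monoˡ-≤; +-monoʳ-≤; *-monoˡ-≤-nonNeg; *-comm;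
         *-cancelˡ-<-nonNeg; suc[i]≤j⇒i<j; i<j⇒suc[i]≤j; i<j⇒i≤pred[j]; pred-suc;
         drop‿+≤+; module ≤-Reasoning)
open import Data.Integer.DivMod using ([n/ℕd]*d≤n; n<s[n/ℕd]*d)
open import Data.Integer.Tactic.RingSolver using (solve-∀)
open import Data.Fin using (Fin; toℕ; zero; suc; _↑ˡ_; _↑ʳ_)
open import Data.Fin.Subset using (Subset; _∩_; ∣_∣; Nonempty; ⊥; ⊤)
open import Data.Fin.Subset.Properties using (∣⊥∣≡0; ∣⊤∣≡n; ∩-zeroˡ; ∩-identityˡ)
open import Data.Vec using ([]; _∷_; _++_; replicate; tabulate; splitAt; here)
open import Data.Vec.Properties using (zipWith-++; tabulate-∘; map-const)
open import Data.Product using (_,_)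
open import Function using (_∘_; const; id)
open import Relation.Binary.PropositionalEquality
  using (refl; sym; trans; cong; cong₂; subst; subst₂; module ≡-Reasoning)

+-cancelʳ-≤ : ∀ i j k → i + k ℤ.≤ j + k → i ℤ.≤ j
+-cancelʳ-≤ i j k = subst₂ ℤ._≤_ (+-cancel i k) (+-cancel j k) ∘ +-monoˡ-≤ (ℤ.- k)
  where
  +-cancel : ∀ x k → x + k + ℤ.- k ≡ x
  +-cancel = solve-∀

2*⌊i/2⌋≤i : ∀ i → + 2 * ⌊ i /2⌋ ℤ.≤ i
2*⌊i/2⌋≤i i = subst (ℤ._≤ i) (*-comm ⌊ i /2⌋ (+ 2)) ([n/ℕd]*d≤n i 2)

i≤2*⌈i/2⌉ : ∀ i → i ℤ.≤ + 2 * ⌈ i /2⌉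
i≤2*⌈i/2⌉ i = +-cancelʳ-≤ i (+ 2 * ⌈ i /2⌉) (+ 1) (subst (i + + 1 ℤ.≤_) (shape ⌈ i /2⌉)
  (i<j⇒i≤pred[j] (n<s[n/ℕd]*d (i + + 1) 2)))
  where
  shape : ∀ c → ℤ.- + 1 + (+ 1 + c) * + 2 ≡ + 2 * c + + 1
  shape = solve-∀

i≤2*j⇒⌈i/2⌉≤j : ∀ {i} j → i ℤ.≤ + 2 * j → ⌈ i /2⌉ ℤ.≤ j
i≤2*j⇒⌈i/2⌉≤j {i} j i≤2j = subst (⌈ i /2⌉ ℤ.≤_) (pred-suc j)
  (i<j⇒i≤pred[j] (*-cancelˡ-<-nonNeg (+ 2) 2⌈i/2⌉<2[1+j]))
  where
  open ≤-Reasoning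
  shape : ∀ j → + 1 + (+ 2 * j + + 1) ≡ + 2 * (+ 1 + j)
  shape = solve-∀
  2⌈i/2⌉<2[1+j] : + 2 * ⌈ i /2⌉ ℤ.< + 2 * ℤ.suc j
  2⌈i/2⌉<2[1+j] = begin-strict
    + 2 * ⌈ i /2⌉          ≤⟨ 2*⌊i/2⌋≤i (i + + 1) ⟩
    i + + 1                ≤⟨ +-monoˡ-≤ (+ 1) i≤2j ⟩
    + 2 * j + + 1          <⟨ suc[i]≤j⇒i<j ≤-refl ⟩
    ℤ.suc (+ 2 * j + + 1)  ≡⟨ shape j ⟩
    + 2 * ℤ.suc j          ∎

1≤i⇒1≤⌈i/2⌉ : ∀ {i} → + 1 ℤ.≤ i → + 1 ℤ.≤ ⌈ i /2⌉
1≤i⇒1≤⌈i/2⌉ {i} 1≤i =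
  i<j⇒suc[i]≤j (*-cancelˡ-<-nonNeg {+ 0} (+ 2) (suc[i]≤j⇒i<j (≤-trans 1≤i (i≤2*⌈i/2⌉ i))))

Majority : ℤ → ℕ → ℕ → Set
Majority k d e = + d + + 2 * k ℤ.≤ + 2 * + e

LeastMajority : ℤ → ℕ → ℕ → Set
LeastMajority k d a = Majority k d a × (∀ e → Majority k d e → a ℕ.≤ e)

k-range⇒bounds : ∀ {m d k} → m ℕ.≤ d → + 1 - ⌈ + m /2⌉ ℤ.≤ k → k ℤ.≤ ⌊ + m /2⌋
               → + 1 ℤ.≤ + d + + 2 * k × + 2 * k ℤ.≤ + d
k-range⇒bounds {m} {d} {k} m≤d lo hi = +-cancelʳ-≤ (+ 1) (+ d + + 2 * k) (+ 1) lower , upper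
  where
  open ≤-Reasoning
  c = ⌈ + m /2⌉
  regroup₁ : ∀ c → + 1 + + 1 ≡ + 2 * (+ 1 - c) + + 2 * c
  regroup₁ = solve-∀
  regroup₂ : ∀ d k → + 2 * k + (d + + 1) ≡ d + + 2 * k + + 1
  regroup₂ = solve-∀
  lower : + 1 + + 1 ℤ.≤ + d + + 2 * k + + 1
  lower = begin
    + 1 + + 1                     ≡⟨ regroup₁ c ⟩
    + 2 * (+ 1 - c) + + 2 * c     ≤⟨ +-mono-≤ (*-monoˡ-≤-nonNeg (+ 2) lo) (2*⌊i/2⌋≤i (+ m + + 1)) ⟩
    + 2 * k + (+ m + + 1)         ≤⟨ +-monoʳ-≤ (+ 2 * k) (+-monoˡ-≤ (+ 1) (+≤+ m≤d)) ⟩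
    + 2 * k + (+ d + + 1)         ≡⟨ regroup₂ (+ d) k ⟩
    + d + + 2 * k + + 1           ∎
  upper : + 2 * k ℤ.≤ + d
  upper = begin
    + 2 * k          ≤⟨ *-monoˡ-≤-nonNeg (+ 2) hi ⟩
    + 2 * ⌊ + m /2⌋  ≤⟨ 2*⌊i/2⌋≤i (+ m) ⟩
    + m              ≤⟨ +≤+ m≤d ⟩
    + d              ∎

least-majority : ∀ d k → + 1 ℤ.≤ + d + + 2 * k × + 2 * k ℤ.≤ + d
               → Σ ℕ λ a → + a ≡ ⌈ + d + + 2 * k /2⌉ × LeastMajority k d a × 1 ℕ.≤ a × a ℕ.≤ d
least-majority d k (1≤x , 2k≤d)
  with ⌈ + d + + 2 * k /2⌉ | i≤2*⌈i/2⌉ (+ d + + 2 * k) | (λ j → i≤2*j⇒⌈i/2⌉≤j {+ d + + 2 * k} j)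
     | 1≤i⇒1≤⌈i/2⌉ 1≤x
... | + a | majority | least | +≤+ 1≤a =
  a , refl , (majority , λ e → drop‿+≤+ ∘ least (+ e)) , 1≤a , drop‿+≤+ (least (+ d) x≤2d)
  where
  doubling : ∀ d → d + d ≡ + 2 * d
  doubling = solve-∀
  x≤2d : + d + + 2 * k ℤ.≤ + 2 * + d
  x≤2d = subst (+ d + + 2 * k ℤ.≤_) (doubling (+ d)) (+-monoʳ-≤ (+ d) 2k≤d)

∣p++q∣≡∣p∣+∣q∣ : ∀ {m n} (p : Subset m) (q : Subset n) → ∣ p ++ q ∣ ≡ ∣ p ∣ ℕ.+ ∣ q ∣
∣p++q∣≡∣p∣+∣q∣ []          q = refl
∣p++q∣≡∣p∣+∣q∣ (true ∷ p)  q = cong suc (∣p++q∣≡∣p∣+∣q∣ p q)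
∣p++q∣≡∣p∣+∣q∣ (false ∷ p) q = ∣p++q∣≡∣p∣+∣q∣ p q

∣⊥++p∣≡∣p∣ : ∀ m {n} (p : Subset n) → ∣ ⊥ {m} ++ p ∣ ≡ ∣ p ∣
∣⊥++p∣≡∣p∣ ℕ.zero p = refl
∣⊥++p∣≡∣p∣ (suc m) p = ∣⊥++p∣≡∣p∣ m p

∣p++⊥∣≡∣p∣ : ∀ {m} (p : Subset m) n → ∣ p ++ ⊥ {n} ∣ ≡ ∣ p ∣
∣p++⊥∣≡∣p∣ p n =
  trans (∣p++q∣≡∣p∣+∣q∣ p ⊥) (trans (cong (∣ p ∣ ℕ.+_) (∣⊥∣≡0 n)) (ℕ.+-identityʳ ∣ p ∣))

∣[⊥++⊤]∩[p++q]∣≡∣q∣ : ∀ {m n} (p : Subset m) (q : Subset n)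
                     → ∣ (⊥ {m} ++ ⊤ {n}) ∩ (p ++ q) ∣ ≡ ∣ q ∣
∣[⊥++⊤]∩[p++q]∣≡∣q∣ {m} {n} p q = begin
  ∣ (⊥ {m} ++ ⊤ {n}) ∩ (p ++ q) ∣ ≡⟨ cong ∣_∣ (zipWith-++ _ ⊥ ⊤ p q) ⟩
  ∣ (⊥ ∩ p) ++ (⊤ ∩ q) ∣          ≡⟨ cong ∣_∣ (cong₂ _++_ (∩-zeroˡ p) (∩-identityˡ q)) ⟩
  ∣ ⊥ {m} ++ q ∣                  ≡⟨ ∣⊥++p∣≡∣p∣ m q ⟩
  ∣ q ∣                           ∎
  where open ≡-Reasoning

∣[⊤++⊥]∩[p++q]∣≡∣p∣ : ∀ {m n} (p : Subset m) (q : Subset n)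
                     → ∣ (⊤ {m} ++ ⊥ {n}) ∩ (p ++ q) ∣ ≡ ∣ p ∣
∣[⊤++⊥]∩[p++q]∣≡∣p∣ {m} {n} p q = begin
  ∣ (⊤ {m} ++ ⊥ {n}) ∩ (p ++ q) ∣ ≡⟨ cong ∣_∣ (zipWith-++ _ ⊤ ⊥ p q) ⟩
  ∣ (⊤ ∩ p) ++ (⊥ ∩ q) ∣          ≡⟨ cong ∣_∣ (cong₂ _++_ (∩-identityˡ p) (∩-zeroˡ q)) ⟩
  ∣ p ++ ⊥ {n} ∣                  ≡⟨ ∣p++⊥∣≡∣p∣ p n ⟩
  ∣ p ∣                           ∎
  where open ≡-Reasoning

initial : ℕ → (n : ℕ) → Subset n
initial a       ℕ.zero  = []
initial ℕ.zero  (suc n) = false ∷ initial ℕ.zero n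
initial (suc a) (suc n) = true ∷ initial a n

∣initial∣ : ∀ {a n} → a ℕ.≤ n → ∣ initial a n ∣ ≡ a
∣initial∣ {ℕ.zero} {ℕ.zero}  z≤n       = refl
∣initial∣ {ℕ.zero} {suc n}   z≤n       = ∣initial∣ {ℕ.zero} {n} z≤n
∣initial∣ {suc a}  {suc n}   (s≤s a≤n) = cong suc (∣initial∣ a≤n)

initial-++-nonempty : ∀ {a n m} (q : Subset m) → 1 ℕ.≤ a → a ℕ.≤ n → Nonempty (initial a n ++ q)
initial-++-nonempty q (s≤s z≤n) (s≤s a≤n) = zero , here

inLeft : ∀ r {t} → Fin (r ℕ.+ t) → Bool
inLeft r v = toℕ v <ᵇ r

inLeft-↑ˡ : ∀ {r} t (i : Fin r) → inLeft r (i ↑ˡ t) ≡ true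
inLeft-↑ˡ t zero    = refl
inLeft-↑ˡ t (suc i) = inLeft-↑ˡ t i

inLeft-↑ʳ : ∀ r {t} (j : Fin t) → inLeft r (r ↑ʳ j) ≡ false
inLeft-↑ʳ ℕ.zero  j = refl
inLeft-↑ʳ (suc r) j = inLeft-↑ʳ r j

N-K : ∀ r t (v : Fin (r ℕ.+ t))
    → N (K r t) v ≡ replicate r (not (inLeft r v)) ++ replicate t (inLeft r v)
N-K r t v = tabulate-xor r (inLeft r v)
  where
  xor-identityʳ : ∀ c → c xor false ≡ c
  xor-identityʳ true  = refl
  xor-identityʳ false = refl
  tabulate-xor : ∀ r c → tabulate {n = r ℕ.+ t} (λ u → c xor inLeft r u)
                       ≡ replicate r (not c) ++ replicate t c
  tabulate-xor ℕ.zero  c     = trans (tabulate-∘ (const (c xor false)) id)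
    (trans (map-const _ _) (cong (replicate t) (xor-identityʳ c)))
  tabulate-xor (suc r) true  = cong (false ∷_) (tabulate-xor r true)
  tabulate-xor (suc r) false = cong (true ∷_) (tabulate-xor r false)

module _ (r t : ℕ) (v : Fin (r ℕ.+ t)) where

  private
    other-part : Bool → Subset (r ℕ.+ t)
    other-part c = replicate r (not c) ++ replicate t c

  N-K-left : inLeft r v ≡ true → N (K r t) v ≡ ⊥ {r} ++ ⊤ {t}
  N-K-left left = trans (N-K r t v) (cong other-part left)

  N-K-right : inLeft r v ≡ false → N (K r t) v ≡ ⊤ {r} ++ ⊥ {t}
  N-K-right right = trans (N-K r t v) (cong other-part right)

  deg-K-left : inLeft r v ≡ true → deg (K r t) v ≡ t
  deg-K-left left = trans (cong ∣_∣ (N-K-left left)) (trans (∣⊥++p∣≡∣p∣ r ⊤) (∣⊤∣≡n t))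

  deg-K-right : inLeft r v ≡ false → deg (K r t) v ≡ r
  deg-K-right right = trans (cong ∣_∣ (N-K-right right)) (trans (∣p++⊥∣≡∣p∣ (⊤ {r}) t) (∣⊤∣≡n r))

  degIn-K-left : inLeft r v ≡ true → (p : Subset r) (q : Subset t) → degIn (K r t) (p ++ q) v ≡ ∣ q ∣
  degIn-K-left left p q =
    trans (cong (λ X → ∣ X ∩ (p ++ q) ∣) (N-K-left left)) (∣[⊥++⊤]∩[p++q]∣≡∣q∣ p q)

  degIn-K-right : inLeft r v ≡ false → (p : Subset r) (q : Subset t) → degIn (K r t) (p ++ q) v ≡ ∣ p ∣
  degIn-K-right right p q =
    trans (cong (λ X → ∣ X ∩ (p ++ q) ∣) (N-K-right right)) (∣[⊤++⊥]∩[p++q]∣≡∣p∣ p q)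

module _ {r t : ℕ} {k : ℤ} {p : Subset r} {q : Subset t} where

  majorities⇒K-monopoly : Nonempty (p ++ q) → Majority k r ∣ p ∣ → Majority k t ∣ q ∣
                        → IsKMonopoly (K r t) k (p ++ q)
  majorities⇒K-monopoly nonempty majority-p majority-q = nonempty , condition
    where
    condition : ∀ v → Majority k (deg (K r t) v) (degIn (K r t) (p ++ q) v)
    condition v = on-side (inLeft r v) refl
      where
      on-side : ∀ c → inLeft r v ≡ c → Majority k (deg (K r t) v) (degIn (K r t) (p ++ q) v)
      on-side true  left  =
        subst₂ (Majority k) (sym (deg-K-left r t v left)) (sym (degIn-K-left r t v left p q)) majority-q
      on-side false right =
        subst₂ (Majority k) (sym (deg-K-right r t v right)) (sym (degIn-K-right r t v right p q)) majority-p

K-monopoly⇒majorities : ∀ {r t k} .{{_ : NonZero r}} .{{_ : NonZero t}} {p : Subset r} {q : Subset t}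
                      → IsKMonopoly (K r t) k (p ++ q) → Majority k r ∣ p ∣ × Majority k t ∣ q ∣
K-monopoly⇒majorities {r@(suc _)} {t@(suc _)} {k} {p} {q} (_ , condition) =
    subst₂ (Majority k) (deg-K-right r t right right-side) (degIn-K-right r t right right-side p q)
      (condition right)
  , subst₂ (Majority k) (deg-K-left r t left left-side) (degIn-K-left r t left left-side p q)
      (condition left)
  where
  left right : Fin (r ℕ.+ t)
  left  = zero ↑ˡ t
  right = r ↑ʳ zero
  left-side : inLeft r left ≡ true
  left-side = inLeft-↑ˡ {r} t zero
  right-side : inLeft r right ≡ false
  right-side = inLeft-↑ʳ r zero

K-monopolyNumber : ∀ {r t k a b} .{{_ : NonZero r}} .{{_ : NonZero t}}
                 → LeastMajority k r a → LeastMajority k t b → 1 ℕ.≤ a → a ℕ.≤ r → b ℕ.≤ t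
                 → MonopolyNumber (K r t) k (a ℕ.+ b)
K-monopolyNumber {r} {t} {k} {a} {b} (majority-a , least-a) (majority-b , least-b) 1≤a a≤r b≤t =
  (M , monopoly , size) , minimal
  where
  M : Subset (r ℕ.+ t)
  M = initial a r ++ initial b t
  monopoly : IsKMonopoly (K r t) k M
  monopoly = majorities⇒K-monopoly {k = k} {p = initial a r} {q = initial b t}
    (initial-++-nonempty (initial b t) 1≤a a≤r)
    (subst (Majority k r) (sym (∣initial∣ a≤r)) majority-a)
    (subst (Majority k t) (sym (∣initial∣ b≤t)) majority-b)
  size : ∣ M ∣ ≡ a ℕ.+ b
  size = trans (∣p++q∣≡∣p∣+∣q∣ (initial a r) (initial b t))
    (cong₂ ℕ._+_ (∣initial∣ a≤r) (∣initial∣ b≤t))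
  minimal : ∀ M′ → IsKMonopoly (K r t) k M′ → a ℕ.+ b ℕ.≤ ∣ M′ ∣
  minimal M′ monopoly′ with splitAt r M′
  ... | p , q , refl with K-monopoly⇒majorities {k = k} {p = p} {q = q} monopoly′
  ...   | majority-p , majority-q = subst (a ℕ.+ b ℕ.≤_) (sym (∣p++q∣≡∣p∣+∣q∣ p q))
    (ℕ.+-mono-≤ (least-a ∣ p ∣ majority-p) (least-b ∣ q ∣ majority-q))

proposition14 : (r t : ℕ) → .{{_ : NonZero r}} → .{{_ : NonZero t}} → (k : ℤ)
    → (+ 1) - ⌈ + (r ⊓ t) /2⌉ ℤ.≤ k → k ℤ.≤ ⌊ + (r ⊓ t) /2⌋
    → Σ ℕ (λ m → MonopolyNumber (K r t) k m
        × (+ m) ≡ ⌈ (+ r) + (+ 2) * k /2⌉ + ⌈ (+ t) + (+ 2) * k /2⌉)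
proposition14 r t k lo hi =
  let a , a≡ , least-a , 1≤a , a≤r = least-majority r k (k-range⇒bounds (ℕ.m⊓n≤m r t) lo hi)
      b , b≡ , least-b , _   , b≤t = least-majority t k (k-range⇒bounds (ℕ.m⊓n≤n r t) lo hi)
  in a ℕ.+ b , K-monopolyNumber {k = k} least-a least-b 1≤a a≤r b≤t , cong₂ _+_ a≡ b≡
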